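{- Let $m = p + 12k$ with $k \geqslant 0$ an integer and $p \in \{11,13,17,19\}$. Suppose that $(X, Y, P_0, Q_0)$ is a type-1 basic set of dipaths of $G_{2m}$. For $j \in \{1,\ldots,k-1\}$ let $P_j = \rho^{12j}(P_0)$ and $Q_j = \rho^{12j}(Q_0)$. Then $C^0 = X P_0 P_1 \cdots P_{k-1}$ and $C^1 = Y Q_0 Q_1 \cdots Q_{k-1}$ (when $k=0$, these are $X$ and $Y$) are type-1 directed $m$-cycles, and $C^0 \cup C^1$ is a $\vec{C}_m$-factor of $G_{2m}$.
   Context: Let $m$ be odd. $G_{2m} = \vec{X}(m,\{1,3\}) \wr K^*_2$, where $\vec{X}(m,\{1,3\})$ has vertex set $\mathbb{Z}_m$ and arcs $(a,a+1),(a,a+3)$ (mod $m$), $K^*_2$ is the complete symmetric digraph on $\{x,y\}$, and the wreath product $G\wr H$ has vertex set $V(G)\times V(H)$ with an arc $(g_1,h_1)\to(g_2,h_2)$ iff $(g_1,g_2)\in A(G)$, or $g_1=g_2$ and $(h_1,h_2)\in A(H)$. Write $x_a=(a,x)$, $y_b=(b,y)$. An arc from a vertex with subscript $a$ to a vertex with subscript $b$ has difference $b-a \bmod m$ (in $\{0,1,3\}$); a directed walk's arcs "sum up to" the sum of their differences; a type-$k$ cycle is a directed $m$-cycle whose arcs sum up to $km$. $\rho: V(G_{2m})\to V(G_{2m})$ is $\rho(x_i)=x_{i+1}$, $\rho(y_i)=y_{i+1}$ (indices mod $m$), extended to dipaths. With $m=p+12k$: $V_0=\{x_0,\ldots,x_{p-1}\}\cup\{y_0,\ldots,y_{p-1}\}$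 and, for $i=1,\ldots,k$, $V_i=\{x_t,y_t : p+12(i-1)\le t\le p+12i-1\}$. For a dipath $P$, $s(P)$ is its first vertex, $t(P)$ its last, $\mathrm{len}(P)$ its number of arcs; $PQ$ denotes concatenation when $t(P)=s(Q)$. A 4-tuple $(X,Y,R,S)$ of dipaths or directed cycles of $G_{2m}$ is a type-1 basic set of dipaths if: (C1) $R$ and $S$ are disjoint; if $k\ge1$ then $X,Y$ are disjoint dipaths, otherwise they are disjoint type-1 directed cycles; (C2) $s(X)=\rho^{ -p}(t(X))$ and $s(Y)=\rho^{ -p}(t(Y))$; (C3) $\mathrm{len}(X)=\mathrm{len}(Y)=p$; $\mathrm{len}(R)=\mathrm{len}(S)=12$ if $k\ge1$ and $0$ if $k=0$; (C4) each of $X,Y$ has its source and internal vertices in $V_0$ and its terminus equal to $x_t$ or $y_t$ for some $t\in\{p,p+1,p+2\}$; (C5) $t(X)=s(R)$, $t(Y)=s(S)$; (C6) if $k\ge1$ and $P\in\{R,S\}$ has $s(P)=x_t$ (resp. $y_t$), then $t(P)=x_{t+12}$ (resp. $y_{t+12}$) and all internal vertices of $P$ lie in $V_1$. A $\vec{C}_m$-factor is a spanning subdigraph that is a disjoint union of directed $m$-cycles. -}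

module Defs where

open import Data.Nat using (ℕ; zero; suc; _+_; _*_; _∸_; _≤_; _<_; _%_)
open import Data.Nat.DivMod using (_mod_)
open import Data.Fin using (Fin; toℕ)
open import Data.Product using (_×_; _,_; proj₁; ∃-syntax)
open import Data.Sum using (_⊎_)
open import Data.List using (List; []; _∷_; upTo; map; foldl; length)
open import Data.List.NonEmpty using (List⁺; _∷_; head; tail; last; toList; _⁺++_)
  renaming (map to map⁺)
open import Data.List.Relation.Unary.All using (All)
open import Data.List.Relation.Unary.Linked using (Linked)
open import Data.List.Relation.Unary.Unique.Propositional using (Unique)
open import Data.List.Membership.Propositional using (_∈_; _∉_)
open import Relation.Binary.PropositionalEquality using (_≡_; _≢_)

data XY : Set where
  x y : XY

-- Vertices of G_{2m}: (a , x) is x_a, (a , y) is y_a, with a ∈ ℤ_m ≅ Fin m.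
Vertex : ℕ → Set
Vertex m = Fin m × XY

_+ᶠ_ : ∀ {m} → Fin m → ℕ → Fin m
_+ᶠ_ {suc n} a j = (toℕ a + j) mod suc n

-- a - j (mod m)
_-ᶠ_ : ∀ {m} → Fin m → ℕ → Fin m
_-ᶠ_ {suc n} a j = (toℕ a + (suc n ∸ (j % suc n))) mod suc n

diff : ∀ {m} → Fin m → Fin m → ℕ
diff a b = toℕ (b -ᶠ toℕ a)

-- Arcs of G_{2m} = X(m,{1,3}) ≀ K*_2
Arc : ∀ {m} → Vertex m → Vertex m → Set
Arc (a , u) (b , v) = (b ≡ a +ᶠ 1) ⊎ (b ≡ a +ᶠ 3) ⊎ (a ≡ b × u ≢ v)

ρ^ : ∀ {m} → ℕ → Vertex m → Vertex m
ρ^ j (a , u) = (a +ᶠ j , u)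

ρ^- : ∀ {m} → ℕ → Vertex m → Vertex m
ρ^- j (a , u) = (a -ᶠ j , u)

Walk : ℕ → Set
Walk m = List⁺ (Vertex m)

ρ^W : ∀ {m} → ℕ → Walk m → Walk m
ρ^W j = map⁺ (ρ^ j)

len : ∀ {m} → Walk m → ℕ
len P = length (tail P)

-- concatenation PQ (intended when t(P) = s(Q))
_⋯_ : ∀ {m} → Walk m → Walk m → Walk m
P ⋯ Q = P ⁺++ tail Q

arcSumL : ∀ {m} → List (Vertex m) → ℕ
arcSumL (u ∷ v ∷ vs) = diff (proj₁ u) (proj₁ v) + arcSumL (v ∷ vs)
arcSumL _ = 0

arcSum : ∀ {m} → Walk m → ℕ
arcSum P = arcSumL (toList P)

dropLastL : {A : Set} → List A → List A
dropLastL [] = []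
dropLastL (a ∷ []) = []
dropLastL (a ∷ b ∷ bs) = a ∷ dropLastL (b ∷ bs)

srcInt : ∀ {m} → Walk m → List (Vertex m)
srcInt P = dropLastL (toList P)

internal : ∀ {m} → Walk m → List (Vertex m)
internal P = dropLastL (tail P)

IsDipath : ∀ {m} → Walk m → Set
IsDipath P = Linked Arc (toList P) × Unique (toList P)

IsDirCycle : ∀ {m} → Walk m → Set
IsDirCycle C = Linked Arc (toList C) × head C ≡ last C × Unique (tail C) × 1 ≤ len C

IsTypeCycle : (m j : ℕ) → Walk m → Set
IsTypeCycle m j C = IsDirCycle C × len C ≡ m × arcSum C ≡ j * m

Disjoint : ∀ {m} → Walk m → Walk m → Set
Disjoint P Q = ∀ v → v ∈ toList P → v ∉ toList Q

concatTails : ∀ {m} → List (Walk m) → List (Vertex m)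
concatTails [] = []
concatTails (C ∷ Cs) = tail C Data.List.++ concatTails Cs

IsCmFactor : (m : ℕ) → List (Walk m) → Set
IsCmFactor m Cs =
  All (λ C → IsDirCycle C × len C ≡ m) Cs
  × (∀ (v : Vertex m) → v ∈ concatTails Cs)
  × Unique (concatTails Cs)

SubscriptIs : ∀ {m} → Fin m → ℕ → Set
SubscriptIs {m} a t = ∃[ q ] (t ≡ toℕ a + q * m)

module _ (p k : ℕ) where
  private
    m = p + 12 * k

  InV0 : Vertex m → Set
  InV0 (a , _) = toℕ a < p

  InV1 : Vertex m → Set
  InV1 (a , _) = p ≤ toℕ a × toℕ a < p + 12

  TerminusOK : Vertex m → Set
  TerminusOK (a , _) = ∃[ t ] ((t ≡ p ⊎ t ≡ p + 1 ⊎ t ≡ p + 2) × SubscriptIs a t)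

  C6 : Walk m → Set
  C6 P = last P ≡ ρ^ 12 (head P) × All InV1 (internal P)

  Type1Basic : (X Y R S : Walk m) → Set
  Type1Basic X Y R S =
    (IsDipath R × IsDipath S × Disjoint R S)
    × (1 ≤ k → IsDipath X × IsDipath Y × Disjoint X Y)
    × (k ≡ 0 → IsTypeCycle m 1 X × IsTypeCycle m 1 Y × Disjoint X Y)
    × (head X ≡ ρ^- p (last X)) × (head Y ≡ ρ^- p (last Y))
    × (len X ≡ p) × (len Y ≡ p)
    × (1 ≤ k → len R ≡ 12 × len S ≡ 12)
    × (k ≡ 0 → len R ≡ 0 × len S ≡ 0)
    × All InV0 (srcInt X) × TerminusOK (last X)
    × All InV0 (srcInt Y) × TerminusOK (last Y)
    × (last X ≡ head R) × (last Y ≡ head S)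
    × (1 ≤ k → C6 R × C6 S)

  chain : Walk m → Walk m → Walk m
  chain X P₀ = foldl _⋯_ X (map (λ j → ρ^W (12 * j) P₀) (upTo k))

-- C2 and C4 place the ends of X at subscripts e and p + e with e ≤ 2,
-- and all other vertices of X below p, so no arc of X wraps around ℤ_m and its arc
-- differences add up to exactly p. Likewise P₀ stays in the window [p, p + 12) up to its
-- last vertex ρ¹²(s(P₀)); its arc sum is 12 modulo m, and the window keeps it closer
-- than m to 12, so it is exactly 12. Concatenating X with the translates ρ¹²ʲ(P₀), j < k,
-- ends at ρ^(p + 12k)(s(X)) = s(X), so C⁰ is a closed walk of length and arc sum p + 12k.
-- Its vertices are those of X (subscripts below p) and of the j-th translate (subscripts
-- in [p + 12j, p + 12j + 12)), hence pairwise distinct and, by (C1), distinct from those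
-- of C¹. Two disjoint m-cycles cover all 2m vertices.

module Submission where

open import Defs
open import Data.Nat using (ℕ; _+_; _*_)
open import Data.Product using (_×_)
open import Data.List using ([]; _∷_)
open import Data.List.Membership.Propositional using (_∈_)

open import Data.Nat using (zero; suc; _∸_; _≤_; _<_; z≤n; s≤s; NonZero; _%_; _/_; _<?_)
open import Data.Nat.Properties
open import Data.Nat.DivMod
open import Data.Fin as Fin using (Fin; toℕ)
open import Data.Fin.Properties using (toℕ-fromℕ<; toℕ<n; toℕ-injective; injective⇒≤; splitAt-join)
open import Data.Product using (∃-syntax; _,_; proj₁; proj₂)
open import Data.Product.Properties using (≡-dec)
open import Data.Sum using (_⊎_; inj₁; inj₂)
open import Data.List as List using (List; _++_; [_]; _∷ʳ_)
open import Data.List.Properties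
  using (∷-injective; ++-assoc; ++-identityʳ; ∷ʳ-injective; length-++; length-map; map-++; foldl-∷ʳ; applyUpTo-∷ʳ)
open import Data.List.NonEmpty as List⁺ using (List⁺; head; tail; last; toList) renaming (_∷_ to _∷⁺_)
open import Data.List.Relation.Unary.All as All using (All) renaming ([] to []ᴬ; _∷_ to _∷ᴬ_)
import Data.List.Relation.Unary.All.Properties as All
open import Data.List.Relation.Unary.Any using (here; there)
open import Data.List.Relation.Unary.Linked as Linked using (Linked; [-]) renaming ([] to []ᴸ; _∷_ to _∷ᴸ_)
import Data.List.Relation.Unary.Linked.Properties as Linked
open import Data.List.Relation.Unary.AllPairs using () renaming ([] to []ᴾ; _∷_ to _∷ᴾ_)
open import Data.List.Relation.Unary.Unique.Propositional using (Unique)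
import Data.List.Relation.Unary.Unique.Propositional.Properties as Unique
open import Data.List.Relation.Binary.Disjoint.Propositional using () renaming (Disjoint to Disjointᴸ)
open import Data.List.Relation.Binary.Disjoint.Propositional.Properties using () renaming (sym to Disjointᴸ-sym)
open import Data.List.Relation.Binary.Permutation.Propositional using (_↭_; ↭-sym; ↭-refl; ↭⇒↭ₛ)
import Data.List.Relation.Binary.Permutation.Propositional.Properties as Perm
import Data.List.Relation.Binary.Permutation.Setoid.Properties as PermSetoid
open import Data.List.Membership.Propositional.Properties using (∈-++⁻; ∈-++⁺ˡ; ∈-map⁻; ∈-lookup)
open import Data.List.Membership.DecPropositional using (_∈?_)
open import Relation.Binary.Definitions using (DecidableEquality; tri<; tri≈; tri>)
open import Relation.Binary.PropositionalEquality hiding ([_])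
open import Relation.Nullary using (¬_; contradiction; yes; no)

[m%d+n]%d≡[m+n]%d : ∀ m n d .{{_ : NonZero d}} → (m % d + n) % d ≡ (m + n) % d
[m%d+n]%d≡[m+n]%d m n d = begin
  (m % d + n) % d             ≡⟨ %-distribˡ-+ (m % d) n d ⟩
  (m % d % d + n % d) % d     ≡⟨ cong (λ r → (r + n % d) % d) (m%n%n≡m%n m d) ⟩
  (m % d + n % d) % d         ≡⟨ %-distribˡ-+ m n d ⟨
  (m + n) % d                 ∎
  where open ≡-Reasoning

%-injective-window : ∀ {m n d} .{{_ : NonZero d}} →
  m ≤ n → n < m + d → m % d ≡ n % d → m ≡ n
%-injective-window {m} {n} {d} m≤n n<m+d m%d≡n%d with <-cmp (m / d) (n / d)
... | tri≈ _ q≡ _ = begin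
  m                  ≡⟨ m≡m%n+[m/n]*n m d ⟩
  m % d + m / d * d  ≡⟨ cong₂ (λ r q → r + q * d) m%d≡n%d q≡ ⟩
  n % d + n / d * d  ≡⟨ m≡m%n+[m/n]*n n d ⟨
  n                  ∎
  where open ≡-Reasoning
... | tri> _ _ q>q′ = contradiction (/-monoˡ-≤ d m≤n) (<⇒≱ q>q′)
... | tri< q<q′ _ _ = contradiction n<m+d (≤⇒≯ (begin
  m + d                      ≡⟨ cong (_+ d) (m≡m%n+[m/n]*n m d) ⟩
  m % d + m / d * d + d      ≡⟨ +-assoc (m % d) _ d ⟩
  m % d + (m / d * d + d)    ≡⟨ cong (m % d +_) (+-comm (m / d * d) d) ⟩
  m % d + suc (m / d) * d    ≤⟨ +-mono-≤ (≤-reflexive m%d≡n%d) (*-monoˡ-≤ d q<q′) ⟩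
  n % d + n / d * d          ≡⟨ m≡m%n+[m/n]*n n d ⟨
  n                          ∎))
  where open ≤-Reasoning

%-injective-window′ : ∀ {m n d} .{{_ : NonZero d}} → m < n + d → n < m + d → m % d ≡ n % d → m ≡ n
%-injective-window′ {m} {n} m<n+d n<m+d eq with ≤-total m n
... | inj₁ m≤n = %-injective-window m≤n n<m+d eq
... | inj₂ n≤m = sym (%-injective-window n≤m m<n+d (sym eq))

module _ {A : Set} where

  last-∷ : (a b : A) (bs : List A) → last (a ∷⁺ b ∷ bs) ≡ last (b ∷⁺ bs)
  last-∷ a b bs with List.initLast bs
  ... | []             = refl
  ... | zs List.∷ʳ′ z  = refl

  ∷-dropLast : (a : A) (cs : List A) → a ∷ cs ≡ dropLastL (a ∷ cs) ∷ʳ last (a ∷⁺ cs)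
  ∷-dropLast a []       = refl
  ∷-dropLast a (b ∷ bs) = cong (a ∷_) (begin
    b ∷ bs                                   ≡⟨ ∷-dropLast b bs ⟩
    dropLastL (b ∷ bs) ∷ʳ last (b ∷⁺ bs)     ≡⟨ cong (dropLastL (b ∷ bs) ∷ʳ_) (last-∷ a b bs) ⟨
    dropLastL (b ∷ bs) ∷ʳ last (a ∷⁺ b ∷ bs) ∎)
    where open ≡-Reasoning

  toList-dropLast : (W : List⁺ A) → toList W ≡ dropLastL (toList W) ∷ʳ last W
  toList-dropLast (a ∷⁺ cs) = ∷-dropLast a cs

  toList-++ : (W : List⁺ A) (bs : List A) → toList W ++ bs ≡ dropLastL (toList W) ++ last W ∷ bs
  toList-++ W bs = trans (cong (_++ bs) (toList-dropLast W)) (++-assoc (dropLastL (toList W)) [ last W ] bs)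

  dropLast-map : {B : Set} (f : A → B) (cs : List A) → dropLastL (List.map f cs) ≡ List.map f (dropLastL cs)
  dropLast-map f []           = refl
  dropLast-map f (a ∷ [])     = refl
  dropLast-map f (a ∷ b ∷ bs) = cong (f a ∷_) (dropLast-map f (b ∷ bs))

  All-last : {P : A → Set} (W : List⁺ A) → All P (toList W) → P (last W)
  All-last W all with All.++⁻ʳ (dropLastL (toList W)) (subst (All _) (toList-dropLast W) all)
  ... | p ∷ᴬ []ᴬ = p

module _ {A B : Set} where

  last-map : (f : A → B) (W : List⁺ A) → last (List⁺.map f W) ≡ f (last W)
  last-map f (a ∷⁺ cs) = ∷-last-map a cs
    where
    ∷-last-map : (a : A) (cs : List A) → last (List⁺.map f (a ∷⁺ cs)) ≡ f (last (a ∷⁺ cs))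
    ∷-last-map a []       = refl
    ∷-last-map a (b ∷ bs) = begin
      last (f a ∷⁺ f b ∷ List.map f bs) ≡⟨ last-∷ (f a) (f b) (List.map f bs) ⟩
      last (f b ∷⁺ List.map f bs)       ≡⟨ ∷-last-map b bs ⟩
      f (last (b ∷⁺ bs))                ≡⟨ cong f (last-∷ a b bs) ⟨
      f (last (a ∷⁺ b ∷ bs))            ∎
      where open ≡-Reasoning

module _ {A : Set} {R : A → A → Set} where

  Linked-join : (cs : List A) {a : A} {bs : List A} →
    Linked R (cs ∷ʳ a) → Linked R (a ∷ bs) → Linked R (cs ++ a ∷ bs)
  Linked-join []            _          l = l
  Linked-join (a ∷ [])      (r ∷ᴸ _)   l = r ∷ᴸ l
  Linked-join (a ∷ a′ ∷ cs) (r ∷ᴸ l′)  l = r ∷ᴸ Linked-join (a′ ∷ cs) l′ l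

  Linked-++⁻ˡ : (cs : List A) {bs : List A} → Linked R (cs ++ bs) → Linked R cs
  Linked-++⁻ˡ []            _         = []ᴸ
  Linked-++⁻ˡ (a ∷ [])      _         = [-]
  Linked-++⁻ˡ (a ∷ a′ ∷ cs) (r ∷ᴸ l)  = r ∷ᴸ Linked-++⁻ˡ (a′ ∷ cs) l

  Linked-++⁻ʳ : (cs : List A) {bs : List A} → Linked R (cs ++ bs) → Linked R bs
  Linked-++⁻ʳ []       l = l
  Linked-++⁻ʳ (a ∷ cs) l = Linked-++⁻ʳ cs (Linked.tail l)

  Linked-last : (W : List⁺ A) {v : A} → Linked R (toList W ∷ʳ v) → R (last W) v
  Linked-last W l with Linked-++⁻ʳ (dropLastL (toList W)) (subst (Linked R) (toList-++ W _) l)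
  ... | r ∷ᴸ _ = r

  Linked-weakenˢ : {R′ : A → A → Set} {P : A → Set} → (∀ {u v} → R u v → P u → R′ u v) →
    (cs : List A) → Linked R cs → All P (dropLastL cs) → Linked R′ cs
  Linked-weakenˢ f []           _        _          = []ᴸ
  Linked-weakenˢ f (a ∷ [])     _        _          = [-]
  Linked-weakenˢ f (a ∷ b ∷ bs) (r ∷ᴸ l) (p ∷ᴬ ps) = f r p ∷ᴸ Linked-weakenˢ f (b ∷ bs) l ps

  Linked-weakenᵗ : {R′ : A → A → Set} {P : A → Set} → (∀ {u v} → R u v → P v → R′ u v) →
    (a : A) (cs : List A) → Linked R (a ∷ cs) → All P cs → Linked R′ (a ∷ cs)
  Linked-weakenᵗ f a []       _        _          = [-]
  Linked-weakenᵗ f a (b ∷ bs) (r ∷ᴸ l) (p ∷ᴬ ps) = f r p ∷ᴸ Linked-weakenᵗ f b bs l ps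

module _ {A : Set} where

  Unique-++⁻ˡ : (xs : List A) {ys : List A} → Unique (xs ++ ys) → Unique xs
  Unique-++⁻ˡ []       _          = []ᴾ
  Unique-++⁻ˡ (a ∷ xs) (a∉ ∷ᴾ u) = All.++⁻ˡ xs a∉ ∷ᴾ Unique-++⁻ˡ xs u

  Unique-resp-↭ : {xs ys : List A} → xs ↭ ys → Unique xs → Unique ys
  Unique-resp-↭ xs↭ys = PermSetoid.Unique-resp-↭ (setoid A) (↭⇒↭ₛ xs↭ys)

  lookup-injective : {xs : List A} → Unique xs → ∀ {i j} → List.lookup xs i ≡ List.lookup xs j → i ≡ j
  lookup-injective (_  ∷ᴾ _) {Fin.zero}  {Fin.zero}  _  = refl
  lookup-injective (a≢ ∷ᴾ _) {Fin.zero}  {Fin.suc j} eq = contradiction eq (All.lookup a≢ (∈-lookup j))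
  lookup-injective (a≢ ∷ᴾ _) {Fin.suc i} {Fin.zero}  eq = contradiction (sym eq) (All.lookup a≢ (∈-lookup i))
  lookup-injective (_  ∷ᴾ u) {Fin.suc i} {Fin.suc j} eq = cong Fin.suc (lookup-injective u eq)

  Unique-length≤ : ∀ {N} (f : A → Fin N) → (∀ {a b} → f a ≡ f b → a ≡ b) →
    {xs : List A} → Unique xs → List.length xs ≤ N
  Unique-length≤ f f-injective {xs} u =
    injective⇒≤ {f = λ i → f (List.lookup xs i)} (λ eq → lookup-injective u (f-injective eq))

tail↭dropLast : {A : Set} {a : A} (t s : List A) → a ∷ t ≡ s ∷ʳ a → t ↭ s
tail↭dropLast t []      eq with ∷-injective eq
... | _ , refl = ↭-refl
tail↭dropLast t (b ∷ s) eq with ∷-injective eq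
... | refl , refl = ↭-sym (Perm.∷↭∷ʳ b s)

Disjoint-++ : {A : Set} {as bs cs ds : List A} → Disjointᴸ as cs → Disjointᴸ as ds →
  Disjointᴸ bs cs → Disjointᴸ bs ds → Disjointᴸ (as ++ bs) (cs ++ ds)
Disjoint-++ {as = as} {cs = cs} ac ad bc bd (v∈ab , v∈cd) with ∈-++⁻ as v∈ab | ∈-++⁻ cs v∈cd
... | inj₁ v∈a | inj₁ v∈c = ac (v∈a , v∈c)
... | inj₁ v∈a | inj₂ v∈d = ad (v∈a , v∈d)
... | inj₂ v∈b | inj₁ v∈c = bc (v∈b , v∈c)
... | inj₂ v∈b | inj₂ v∈d = bd (v∈b , v∈d)

-- Arithmetic in ℤ_m, with m = suc n and ℤ_m represented by Fin m

module _ {n : ℕ} where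
  private
    M = suc n

  toℕ-+ᶠ : (a : Fin M) (j : ℕ) → toℕ (a +ᶠ j) ≡ (toℕ a + j) % M
  toℕ-+ᶠ a j = toℕ-fromℕ< (m%n<n (toℕ a + j) M)

  toℕ-+ᶠ-< : (a : Fin M) (j : ℕ) → toℕ a + j < M → toℕ (a +ᶠ j) ≡ toℕ a + j
  toℕ-+ᶠ-< a j a+j<M = trans (toℕ-+ᶠ a j) (m<n⇒m%n≡m a+j<M)

  +ᶠ-identityʳ : (a : Fin M) → a +ᶠ 0 ≡ a
  +ᶠ-identityʳ a = toℕ-injective (trans (toℕ-+ᶠ a 0)
    (trans (cong (_% M) (+-identityʳ (toℕ a))) (m<n⇒m%n≡m (toℕ<n a))))

  +ᶠ-assoc : (a : Fin M) (i j : ℕ) → (a +ᶠ i) +ᶠ j ≡ a +ᶠ (i + j)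
  +ᶠ-assoc a i j = toℕ-injective (begin
    toℕ ((a +ᶠ i) +ᶠ j)       ≡⟨ toℕ-+ᶠ (a +ᶠ i) j ⟩
    (toℕ (a +ᶠ i) + j) % M    ≡⟨ cong (λ r → (r + j) % M) (toℕ-+ᶠ a i) ⟩
    ((toℕ a + i) % M + j) % M ≡⟨ [m%d+n]%d≡[m+n]%d (toℕ a + i) j M ⟩
    (toℕ a + i + j) % M       ≡⟨ cong (_% M) (+-assoc (toℕ a) i j) ⟩
    (toℕ a + (i + j)) % M     ≡⟨ toℕ-+ᶠ a (i + j) ⟨
    toℕ (a +ᶠ (i + j))        ∎)
    where open ≡-Reasoning

  +ᶠ-swap : (a : Fin M) (i j : ℕ) → (a +ᶠ i) +ᶠ j ≡ (a +ᶠ j) +ᶠ i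
  +ᶠ-swap a i j = begin
    (a +ᶠ i) +ᶠ j   ≡⟨ +ᶠ-assoc a i j ⟩
    a +ᶠ (i + j)    ≡⟨ cong (a +ᶠ_) (+-comm i j) ⟩
    a +ᶠ (j + i)    ≡⟨ +ᶠ-assoc a j i ⟨
    (a +ᶠ j) +ᶠ i   ∎
    where open ≡-Reasoning

  +ᶠ-multiple : (a : Fin M) (c : ℕ) → a +ᶠ (c * M) ≡ a
  +ᶠ-multiple a c = toℕ-injective (trans (toℕ-+ᶠ a (c * M))
    (trans ([m+kn]%n≡m%n (toℕ a) c M) (m<n⇒m%n≡m (toℕ<n a))))

  -- a -ᶠ j unfolds to a +ᶠ (M ∸ j % M), and M ∸ j % M complements j to a multiple of M.
  complement+j≡multiple : (j : ℕ) → (M ∸ j % M) + j ≡ suc (j / M) * M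
  complement+j≡multiple j = begin
    (M ∸ j % M) + j                  ≡⟨ cong ((M ∸ j % M) +_) (m≡m%n+[m/n]*n j M) ⟩
    (M ∸ j % M) + (j % M + j / M * M) ≡⟨ +-assoc (M ∸ j % M) (j % M) _ ⟨
    (M ∸ j % M) + j % M + j / M * M   ≡⟨ cong (_+ j / M * M) (m∸n+n≡m (m%n≤n j M)) ⟩
    M + j / M * M                     ∎
    where open ≡-Reasoning

  -ᶠ-+ᶠ : (a : Fin M) (j : ℕ) → (a -ᶠ j) +ᶠ j ≡ a
  -ᶠ-+ᶠ a j = begin
    (a +ᶠ (M ∸ j % M)) +ᶠ j   ≡⟨ +ᶠ-assoc a (M ∸ j % M) j ⟩
    a +ᶠ ((M ∸ j % M) + j)    ≡⟨ cong (a +ᶠ_) (complement+j≡multiple j) ⟩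
    a +ᶠ (suc (j / M) * M)    ≡⟨ +ᶠ-multiple a (suc (j / M)) ⟩
    a                         ∎
    where open ≡-Reasoning

  +ᶠ--ᶠ : (a : Fin M) (j : ℕ) → (a +ᶠ j) -ᶠ j ≡ a
  +ᶠ--ᶠ a j = begin
    (a +ᶠ j) +ᶠ (M ∸ j % M)   ≡⟨ +ᶠ-assoc a j (M ∸ j % M) ⟩
    a +ᶠ (j + (M ∸ j % M))    ≡⟨ cong (a +ᶠ_) (trans (+-comm j _) (complement+j≡multiple j)) ⟩
    a +ᶠ (suc (j / M) * M)    ≡⟨ +ᶠ-multiple a (suc (j / M)) ⟩
    a                         ∎
    where open ≡-Reasoning

  toℕ--ᶠ : (a : Fin M) (j : ℕ) → j ≤ toℕ a → toℕ (a -ᶠ j) ≡ toℕ a ∸ j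
  toℕ--ᶠ a j j≤a = begin
    toℕ (a +ᶠ (M ∸ j % M))      ≡⟨ toℕ-+ᶠ a (M ∸ j % M) ⟩
    (toℕ a + (M ∸ j % M)) % M   ≡⟨ cong (λ r → (toℕ a + (M ∸ r)) % M) (m<n⇒m%n≡m j<M) ⟩
    (toℕ a + (M ∸ j)) % M       ≡⟨ cong (_% M) shift ⟩
    (toℕ a ∸ j + M) % M         ≡⟨ [m+n]%n≡m%n (toℕ a ∸ j) M ⟩
    (toℕ a ∸ j) % M             ≡⟨ m<n⇒m%n≡m (≤-<-trans (m∸n≤m (toℕ a) j) (toℕ<n a)) ⟩
    toℕ a ∸ j                   ∎
    where
      open ≡-Reasoning
      j<M : j < M
      j<M = ≤-<-trans j≤a (toℕ<n a)
      shift : toℕ a + (M ∸ j) ≡ toℕ a ∸ j + M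
      shift = begin
        toℕ a + (M ∸ j)         ≡⟨ +-∸-assoc (toℕ a) (<⇒≤ j<M) ⟨
        toℕ a + M ∸ j           ≡⟨ cong (_∸ j) (+-comm (toℕ a) M) ⟩
        M + toℕ a ∸ j           ≡⟨ +-∸-assoc M j≤a ⟩
        M + (toℕ a ∸ j)         ≡⟨ +-comm M _ ⟩
        toℕ a ∸ j + M           ∎

  +ᶠ-toℕ-comm : (a b : Fin M) → a +ᶠ toℕ b ≡ b +ᶠ toℕ a
  +ᶠ-toℕ-comm a b = toℕ-injective (begin
    toℕ (a +ᶠ toℕ b)      ≡⟨ toℕ-+ᶠ a (toℕ b) ⟩
    (toℕ a + toℕ b) % M   ≡⟨ cong (_% M) (+-comm (toℕ a) (toℕ b)) ⟩
    (toℕ b + toℕ a) % M   ≡⟨ toℕ-+ᶠ b (toℕ a) ⟨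
    toℕ (b +ᶠ toℕ a)      ∎)
    where open ≡-Reasoning

  +ᶠ-diff : (a b : Fin M) → a +ᶠ diff a b ≡ b
  +ᶠ-diff a b = trans (+ᶠ-toℕ-comm a (b -ᶠ toℕ a)) (-ᶠ-+ᶠ b (toℕ a))

  diff-+ᶠ : (a : Fin M) (d : ℕ) → d < M → diff a (a +ᶠ d) ≡ d
  diff-+ᶠ a d d<M = begin
    toℕ ((a +ᶠ d) -ᶠ toℕ a)       ≡⟨ cong (λ b → toℕ ((a +ᶠ b) -ᶠ toℕ a)) (toℕ-fromℕ< d<M) ⟨
    toℕ ((a +ᶠ toℕ δ) -ᶠ toℕ a)   ≡⟨ cong (λ b → toℕ (b -ᶠ toℕ a)) (+ᶠ-toℕ-comm a δ) ⟩
    toℕ ((δ +ᶠ toℕ a) -ᶠ toℕ a)   ≡⟨ cong toℕ (+ᶠ--ᶠ δ (toℕ a)) ⟩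
    toℕ δ                         ≡⟨ toℕ-fromℕ< d<M ⟩
    d                             ∎
    where
      open ≡-Reasoning
      δ = Fin.fromℕ< d<M

  diff-+ᶠ-cong : (a b : Fin M) (j : ℕ) → diff (a +ᶠ j) (b +ᶠ j) ≡ diff a b
  diff-+ᶠ-cong a b j = begin
    diff (a +ᶠ j) (b +ᶠ j)                      ≡⟨ cong (λ c → diff (a +ᶠ j) (c +ᶠ j)) (+ᶠ-diff a b) ⟨
    diff (a +ᶠ j) ((a +ᶠ diff a b) +ᶠ j)        ≡⟨ cong (diff (a +ᶠ j)) (+ᶠ-swap a (diff a b) j) ⟩
    diff (a +ᶠ j) ((a +ᶠ j) +ᶠ diff a b)        ≡⟨ diff-+ᶠ (a +ᶠ j) (diff a b) (toℕ<n (b -ᶠ toℕ a)) ⟩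
    diff a b                                    ∎
    where open ≡-Reasoning

  toℕ-unwrapped : (a b : Fin M) → toℕ a + diff a b < M → toℕ b ≡ toℕ a + diff a b
  toℕ-unwrapped a b no-wrap =
    trans (cong toℕ (sym (+ᶠ-diff a b))) (toℕ-+ᶠ-< a (diff a b) no-wrap)

  toℕ-wrapped : (a b : Fin M) → M ≤ toℕ a + diff a b → toℕ b < diff a b
  toℕ-wrapped a b wrap = begin-strict
    toℕ b                               ≡⟨ cong toℕ (+ᶠ-diff a b) ⟨
    toℕ (a +ᶠ diff a b)                 ≡⟨ toℕ-+ᶠ a (diff a b) ⟩
    (toℕ a + diff a b) % M              ≡⟨ m≤n⇒[n∸m]%m≡n%m wrap ⟨
    (toℕ a + diff a b ∸ M) % M          ≤⟨ m%n≤m _ M ⟩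
    toℕ a + diff a b ∸ M                <⟨ ∸-monoˡ-< (+-monoˡ-< (diff a b) (toℕ<n a)) wrap ⟩
    M + diff a b ∸ M                    ≡⟨ m+n∸m≡n M (diff a b) ⟩
    diff a b                            ∎
    where open ≤-Reasoning

-- Vertices, arcs and the rotation ρ

sub : ∀ {m} → Vertex m → ℕ
sub (a , _) = toℕ a

arcDiff : ∀ {m} → Vertex m → Vertex m → ℕ
arcDiff u v = diff (proj₁ u) (proj₁ v)

InWindow : ∀ {m} → ℕ → ℕ → Vertex m → Set
InWindow p c v = p ≤ sub v × sub v < p + c

module _ {n : ℕ} where
  private
    M = suc n

  ρ^-∘ : (i j : ℕ) (v : Vertex M) → ρ^ j (ρ^ i v) ≡ ρ^ (i + j) v
  ρ^-∘ i j (a , s) = cong (_, s) (+ᶠ-assoc a i j)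

  ρ^-zero : (v : Vertex M) → ρ^ 0 v ≡ v
  ρ^-zero (a , s) = cong (_, s) (+ᶠ-identityʳ a)

  ρ^-multiple : (c : ℕ) (v : Vertex M) → ρ^ (c * M) v ≡ v
  ρ^-multiple c (a , s) = cong (_, s) (+ᶠ-multiple a c)

  ρ^-ρ^- : (j : ℕ) (v : Vertex M) → ρ^ j (ρ^- j v) ≡ v
  ρ^-ρ^- j (a , s) = cong (_, s) (-ᶠ-+ᶠ a j)

  ρ^--ρ^ : (j : ℕ) (v : Vertex M) → ρ^- j (ρ^ j v) ≡ v
  ρ^--ρ^ j (a , s) = cong (_, s) (+ᶠ--ᶠ a j)

  ρ^-injective : (j : ℕ) {u w : Vertex M} → ρ^ j u ≡ ρ^ j w → u ≡ w
  ρ^-injective j {u} {w} eq = begin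
    u                 ≡⟨ ρ^--ρ^ j u ⟨
    ρ^- j (ρ^ j u)    ≡⟨ cong (ρ^- j) eq ⟩
    ρ^- j (ρ^ j w)    ≡⟨ ρ^--ρ^ j w ⟩
    w                 ∎
    where open ≡-Reasoning

  sub-ρ^ : (j : ℕ) (v : Vertex M) → sub v + j < M → sub (ρ^ j v) ≡ sub v + j
  sub-ρ^ j (a , _) = toℕ-+ᶠ-< a j

  sub-ρ^- : (j : ℕ) (v : Vertex M) → j ≤ sub v → sub (ρ^- j v) ≡ sub v ∸ j
  sub-ρ^- j (a , _) = toℕ--ᶠ a j

  arcDiff-ρ^ : (j : ℕ) (u v : Vertex M) → arcDiff (ρ^ j u) (ρ^ j v) ≡ arcDiff u v
  arcDiff-ρ^ j (a , _) (b , _) = diff-+ᶠ-cong a b j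

  Arc-step : {u v : Vertex M} → Arc u v → ∃[ d ] d ≤ 3 × proj₁ v ≡ proj₁ u +ᶠ d
  Arc-step         (inj₁ e)              = 1 , s≤s z≤n , e
  Arc-step         (inj₂ (inj₁ e))       = 3 , ≤-refl , e
  Arc-step {a , _} (inj₂ (inj₂ (e , _))) = 0 , z≤n , trans (sym e) (sym (+ᶠ-identityʳ a))

  ρ^-Arc : (j : ℕ) {u v : Vertex M} → Arc u v → Arc (ρ^ j u) (ρ^ j v)
  ρ^-Arc j {a , _} (inj₁ e)                = inj₁ (trans (cong (_+ᶠ j) e) (+ᶠ-swap a 1 j))
  ρ^-Arc j {a , _} (inj₂ (inj₁ e))         = inj₂ (inj₁ (trans (cong (_+ᶠ j) e) (+ᶠ-swap a 3 j)))
  ρ^-Arc j         (inj₂ (inj₂ (e , s≢t))) = inj₂ (inj₂ (cong (_+ᶠ j) e , s≢t))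

  arcDiff-Arc : 3 < M → {u v : Vertex M} → Arc u v → arcDiff u v ≤ 3
  arcDiff-Arc 3<M {a , _} {b , _} arc with Arc-step arc
  ... | d , d≤3 , refl = ≤-trans (≤-reflexive (diff-+ᶠ a d (≤-<-trans d≤3 3<M))) d≤3

  Unwrapped : Vertex M → Vertex M → Set
  Unwrapped u v = sub v ≡ sub u + arcDiff u v

  -- An arc can only wrap around from one of the last three subscripts to one of the first three.
  Arc-unwrapped : 3 < M → {u v : Vertex M} → Arc u v → sub u + 3 < M ⊎ 3 ≤ sub v → Unwrapped u v
  Arc-unwrapped 3<M {a , _} {b , _} arc side with toℕ a + diff a b <? M
  ... | yes no-wrap = toℕ-unwrapped a b no-wrap
  ... | no wrap with side
  ...   | inj₁ a+3<M = contradiction (≤-<-trans (+-monoʳ-≤ (toℕ a) (arcDiff-Arc 3<M arc)) a+3<M) wrap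
  ...   | inj₂ 3≤b   = contradiction (<-≤-trans (toℕ-wrapped a b (≮⇒≥ wrap)) (arcDiff-Arc 3<M arc)) (≤⇒≯ 3≤b)

_≟ˣʸ_ : DecidableEquality XY
x ≟ˣʸ x = yes refl
x ≟ˣʸ y = no (λ ())
y ≟ˣʸ x = no (λ ())
y ≟ˣʸ y = yes refl

module _ {M : ℕ} where

  _≟ᵛ_ : DecidableEquality (Vertex M)
  _≟ᵛ_ = ≡-dec Fin._≟_ _≟ˣʸ_

  private
    layer : Vertex M → Fin M ⊎ Fin M
    layer (a , x) = inj₁ a
    layer (a , y) = inj₂ a

    layer-injective : ∀ {u v} → layer u ≡ layer v → u ≡ v
    layer-injective {a , x} {b , x} refl = refl
    layer-injective {a , y} {b , y} refl = refl
    layer-injective {a , x} {b , y} ()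
    layer-injective {a , y} {b , x} ()

  vertex-index : Vertex M → Fin (M + M)
  vertex-index v = Fin.join M M (layer v)

  vertex-index-injective : ∀ {u v} → vertex-index u ≡ vertex-index v → u ≡ v
  vertex-index-injective {u} {v} eq = layer-injective (begin
    layer u                              ≡⟨ splitAt-join M M (layer u) ⟨
    Fin.splitAt M (vertex-index u)       ≡⟨ cong (Fin.splitAt M) eq ⟩
    Fin.splitAt M (vertex-index v)       ≡⟨ splitAt-join M M (layer v) ⟩
    layer v                              ∎)
    where open ≡-Reasoning

  Unique-covers : {vs : List (Vertex M)} → Unique vs → List.length vs ≡ M + M → ∀ v → v ∈ vs
  Unique-covers {vs} u length≡ v with _∈?_ _≟ᵛ_ v vs
  ... | yes v∈ = v∈
  ... | no  v∉ = contradiction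
    (Unique-length≤ vertex-index vertex-index-injective (All.¬Any⇒All¬ vs v∉ ∷ᴾ u))
    (subst (λ l → ¬ suc l ≤ M + M) (sym length≡) (n≮n (M + M)))

-- Walks, their arc sums and concatenation

srcInt-∷ : ∀ {m} (W : Walk m) → 1 ≤ len W → srcInt W ≡ head W ∷ internal W
srcInt-∷ (a ∷⁺ b ∷ bs) _ = refl

∈-srcInt : ∀ {m} (W : Walk m) {v : Vertex m} → v ∈ srcInt W → v ∈ toList W
∈-srcInt W v∈ = subst (_ ∈_) (sym (toList-dropLast W)) (∈-++⁺ˡ v∈)

Disjoint-srcInt : ∀ {m} {P Q : Walk m} → Disjoint P Q → Disjointᴸ (srcInt P) (srcInt Q)
Disjoint-srcInt {P = P} {Q} disjoint (v∈P , v∈Q) = disjoint _ (∈-srcInt P v∈P) (∈-srcInt Q v∈Q)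

Unique-srcInt : ∀ {m} (W : Walk m) → Unique (toList W) → Unique (srcInt W)
Unique-srcInt W unique = Unique-++⁻ˡ (srcInt W) (subst Unique (toList-dropLast W) unique)

low-high-disjoint : ∀ {m p} {vs ws : List (Vertex m)} → All (λ v → sub v < p) vs →
  (∀ {v} → v ∈ ws → p ≤ sub v) → Disjointᴸ vs ws
low-high-disjoint low high (v∈vs , v∈ws) = <⇒≱ (All.lookup low v∈vs) (high v∈ws)

module _ {m : ℕ} where

  arcSum-join : (us : List (Vertex m)) (a : Vertex m) (ws : List (Vertex m)) →
    arcSumL (us ++ a ∷ ws) ≡ arcSumL (us ∷ʳ a) + arcSumL (a ∷ ws)
  arcSum-join []            a ws = refl
  arcSum-join (u ∷ [])      a ws = cong (_+ arcSumL (a ∷ ws)) (sym (+-identityʳ (arcDiff u a)))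
  arcSum-join (u ∷ u′ ∷ us) a ws =
    trans (cong (arcDiff u u′ +_) (arcSum-join (u′ ∷ us) a ws)) (sym (+-assoc (arcDiff u u′) _ _))

  arcSum-snoc : (W : Walk m) (v : Vertex m) → arcSumL (toList W ∷ʳ v) ≡ arcSum W + arcDiff (last W) v
  arcSum-snoc W v = begin
    arcSumL (toList W ∷ʳ v)
      ≡⟨ cong arcSumL (toList-++ W [ v ]) ⟩
    arcSumL (srcInt W ++ last W ∷ [ v ])
      ≡⟨ arcSum-join (srcInt W) (last W) [ v ] ⟩
    arcSumL (srcInt W ∷ʳ last W) + (arcDiff (last W) v + 0)
      ≡⟨ cong₂ _+_ (cong arcSumL (toList-dropLast W)) (sym (+-identityʳ _)) ⟨
    arcSum W + arcDiff (last W) v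
      ∎
    where open ≡-Reasoning

  module _ (A B : Walk m) (joined : last A ≡ head B) where

    toList-⋯ : toList (A ⋯ B) ≡ (srcInt A ++ srcInt B) ∷ʳ last B
    toList-⋯ = begin
      toList A ++ tail B                ≡⟨ toList-++ A (tail B) ⟩
      srcInt A ++ last A ∷ tail B       ≡⟨ cong (λ h → srcInt A ++ h ∷ tail B) joined ⟩
      srcInt A ++ toList B              ≡⟨ cong (srcInt A ++_) (toList-dropLast B) ⟩
      srcInt A ++ (srcInt B ∷ʳ last B)  ≡⟨ ++-assoc (srcInt A) (srcInt B) [ last B ] ⟨
      (srcInt A ++ srcInt B) ∷ʳ last B  ∎
      where open ≡-Reasoning

    private
      split-⋯ : srcInt (A ⋯ B) ≡ srcInt A ++ srcInt B × last (A ⋯ B) ≡ last B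
      split-⋯ = ∷ʳ-injective (srcInt (A ⋯ B)) (srcInt A ++ srcInt B)
        (trans (sym (toList-dropLast (A ⋯ B))) toList-⋯)

    srcInt-⋯ : srcInt (A ⋯ B) ≡ srcInt A ++ srcInt B
    srcInt-⋯ = proj₁ split-⋯

    last-⋯ : last (A ⋯ B) ≡ last B
    last-⋯ = proj₂ split-⋯

    Linked-⋯ : {R : Vertex m → Vertex m → Set} →
      Linked R (toList A) → Linked R (toList B) → Linked R (toList (A ⋯ B))
    Linked-⋯ {R} lA lB = subst (Linked R) (sym (toList-++ A (tail B)))
      (Linked-join (srcInt A) (subst (Linked R) (toList-dropLast A) lA)
                              (subst (λ h → Linked R (h ∷ tail B)) (sym joined) lB))

    arcSum-⋯ : arcSum (A ⋯ B) ≡ arcSum A + arcSum B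
    arcSum-⋯ = begin
      arcSumL (toList A ++ tail B)
        ≡⟨ cong arcSumL (toList-++ A (tail B)) ⟩
      arcSumL (srcInt A ++ last A ∷ tail B)
        ≡⟨ arcSum-join (srcInt A) (last A) (tail B) ⟩
      arcSumL (srcInt A ∷ʳ last A) + arcSumL (last A ∷ tail B)
        ≡⟨ cong₂ _+_ (cong arcSumL (toList-dropLast A)) (cong (λ h → arcSumL (h ∷ tail B)) (sym joined)) ⟨
      arcSum A + arcSum B
        ∎
      where open ≡-Reasoning

  len-⋯ : (A B : Walk m) → len (A ⋯ B) ≡ len A + len B
  len-⋯ A B = length-++ (tail A)

  last-ρ^W : (j : ℕ) (W : Walk m) → last (ρ^W j W) ≡ ρ^ j (last W)
  last-ρ^W j = last-map (ρ^ j)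

  srcInt-ρ^W : (j : ℕ) (W : Walk m) → srcInt (ρ^W j W) ≡ List.map (ρ^ j) (srcInt W)
  srcInt-ρ^W j W = dropLast-map (ρ^ j) (toList W)

  len-ρ^W : (j : ℕ) (W : Walk m) → len (ρ^W j W) ≡ len W
  len-ρ^W j W = length-map (ρ^ j) (tail W)

module _ {n : ℕ} where
  private
    M = suc n

  Linked-ρ^W : (j : ℕ) (W : Walk M) → Linked Arc (toList W) → Linked Arc (toList (ρ^W j W))
  Linked-ρ^W j W l = Linked.map⁺ (Linked.map (ρ^-Arc j) l)

  arcSum-ρ^W : (j : ℕ) (W : Walk M) → arcSum (ρ^W j W) ≡ arcSum W
  arcSum-ρ^W j W = go (toList W)
    where
    go : (us : List (Vertex M)) → arcSumL (List.map (ρ^ j) us) ≡ arcSumL us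
    go []            = refl
    go (u ∷ [])      = refl
    go (u ∷ u′ ∷ us) = cong₂ _+_ (arcDiff-ρ^ j u u′) (go (u′ ∷ us))

  telescope : (W : Walk M) → Linked Unwrapped (toList W) → sub (last W) ≡ sub (head W) + arcSum W
  telescope (a ∷⁺ cs) = go a cs
    where
    go : (a : Vertex M) (cs : List (Vertex M)) → Linked Unwrapped (a ∷ cs) →
      sub (last (a ∷⁺ cs)) ≡ sub a + arcSumL (a ∷ cs)
    go a []       _        = sym (+-identityʳ (sub a))
    go a (b ∷ bs) (e ∷ᴸ l) = begin
      sub (last (a ∷⁺ b ∷ bs))                      ≡⟨ cong sub (last-∷ a b bs) ⟩
      sub (last (b ∷⁺ bs))                          ≡⟨ go b bs l ⟩
      sub b + arcSumL (b ∷ bs)                      ≡⟨ cong (_+ arcSumL (b ∷ bs)) e ⟩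
      sub a + arcDiff a b + arcSumL (b ∷ bs)        ≡⟨ +-assoc (sub a) _ _ ⟩
      sub a + arcSumL (a ∷ b ∷ bs)                  ∎
      where open ≡-Reasoning

module _ {m : ℕ} where

  tail↭srcInt : (C : Walk m) → head C ≡ last C → tail C ↭ srcInt C
  tail↭srcInt C closed =
    tail↭dropLast (tail C) (srcInt C) (trans (toList-dropLast C) (cong (srcInt C ∷ʳ_) (sym closed)))

  closed-IsDirCycle : (C : Walk m) → Linked Arc (toList C) → head C ≡ last C →
    Unique (srcInt C) → 1 ≤ len C → IsDirCycle C
  closed-IsDirCycle C linked closed unique 1≤len =
    linked , closed , Unique-resp-↭ (↭-sym (tail↭srcInt C closed)) unique , 1≤len

  IsCmFactor-pair : (C₀ C₁ : Walk m) → IsDirCycle C₀ → IsDirCycle C₁ → len C₀ ≡ m → len C₁ ≡ m →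
    Unique (tail C₀ ++ tail C₁) → IsCmFactor m (C₀ ∷ C₁ ∷ [])
  IsCmFactor-pair C₀ C₁ cycle₀ cycle₁ len₀ len₁ unique =
    (cycle₀ , len₀) ∷ᴬ (cycle₁ , len₁) ∷ᴬ []ᴬ ,
    (λ v → subst (v ∈_) (sym tails≡) (Unique-covers unique length≡ v)) ,
    subst Unique (sym tails≡) unique
    where
    tails≡ : concatTails (C₀ ∷ C₁ ∷ []) ≡ tail C₀ ++ tail C₁
    tails≡ = cong (tail C₀ ++_) (++-identityʳ (tail C₁))

    length≡ : List.length (tail C₀ ++ tail C₁) ≡ m + m
    length≡ = trans (length-++ (tail C₀)) (cong₂ _+_ len₀ len₁)

module _ {n : ℕ} where
  private
    M = suc n

  telescope-below : (W : Walk M) → 3 < M → Linked Arc (toList W) →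
    All (λ v → sub v + 3 < M) (srcInt W) → sub (last W) ≡ sub (head W) + arcSum W
  telescope-below W 3<M linked low = telescope W
    (Linked-weakenˢ (λ arc u-low → Arc-unwrapped 3<M arc (inj₁ u-low)) (toList W) linked low)

  telescope-mod : (W : Walk M) → (sub (head W) + arcSum W) % M ≡ sub (last W)
  telescope-mod (a ∷⁺ cs) = go a cs
    where
    go : (a : Vertex M) (cs : List (Vertex M)) → (sub a + arcSumL (a ∷ cs)) % M ≡ sub (last (a ∷⁺ cs))
    go a []       = trans (cong (_% M) (+-identityʳ (sub a))) (m<n⇒m%n≡m (toℕ<n (proj₁ a)))
    go a (b ∷ bs) = begin
      (sub a + (arcDiff a b + arcSumL (b ∷ bs))) % M      ≡⟨ cong (_% M) (+-assoc (sub a) (arcDiff a b) _) ⟨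
      (sub a + arcDiff a b + arcSumL (b ∷ bs)) % M        ≡⟨ [m%d+n]%d≡[m+n]%d (sub a + arcDiff a b) _ M ⟨
      ((sub a + arcDiff a b) % M + arcSumL (b ∷ bs)) % M  ≡⟨ cong (λ r → (r + arcSumL (b ∷ bs)) % M) step ⟩
      (sub b + arcSumL (b ∷ bs)) % M                      ≡⟨ go b bs ⟩
      sub (last (b ∷⁺ bs))                                ≡⟨ cong sub (last-∷ a b bs) ⟨
      sub (last (a ∷⁺ b ∷ bs))                            ∎
      where
      open ≡-Reasoning
      step : (sub a + arcDiff a b) % M ≡ sub b
      step = trans (sym (toℕ-+ᶠ (proj₁ a) (arcDiff a b))) (cong toℕ (+ᶠ-diff (proj₁ a) (proj₁ b)))

  -- Arcs entering the window cannot wrap, so only the last arc of P leaves it, by at most 3.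
  arcSum-window-bound : ∀ {p c} (P : Walk M) → 3 ≤ p → Linked Arc (toList P) → 1 ≤ len P →
    All (InWindow p c) (srcInt P) → sub (head P) + arcSum P < p + c + 3
  arcSum-window-bound {p} {c} P 3≤p linked 1≤len window = begin-strict
    sub (head P) + arcSum P                      ≡⟨ cong (λ l → sub (head P) + arcSumL l) toList≡ ⟩
    sub (head P) + arcSumL (toList Q ∷ʳ last P)  ≡⟨ cong (sub (head P) +_) (arcSum-snoc Q (last P)) ⟩
    sub (head P) + (arcSum Q + δ)                ≡⟨ +-assoc (sub (head P)) (arcSum Q) δ ⟨
    sub (head P) + arcSum Q + δ                  ≡⟨ cong (_+ δ) (telescope Q Q-unwrapped) ⟨
    sub (last Q) + δ                             <⟨ +-mono-<-≤ (proj₂ (All-last Q Q-window)) (arcDiff-Arc 3<M last-arc) ⟩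
    p + c + 3                                    ∎
    where
    open ≤-Reasoning
    Q : Walk M
    Q = head P ∷⁺ internal P

    srcInt≡ : srcInt P ≡ toList Q
    srcInt≡ = srcInt-∷ P 1≤len

    toList≡ : toList P ≡ toList Q ∷ʳ last P
    toList≡ = trans (toList-dropLast P) (cong (_∷ʳ last P) srcInt≡)

    Q-window : All (InWindow p c) (toList Q)
    Q-window = subst (All (InWindow p c)) srcInt≡ window

    Q∷P-linked : Linked Arc (toList Q ∷ʳ last P)
    Q∷P-linked = subst (Linked Arc) toList≡ linked

    last-arc : Arc (last Q) (last P)
    last-arc = Linked-last Q Q∷P-linked

    3<M : 3 < M
    3<M = ≤-<-trans (≤-trans 3≤p (proj₁ (All.head Q-window))) (toℕ<n (proj₁ (head P)))

    Q-unwrapped : Linked Unwrapped (toList Q)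
    Q-unwrapped = Linked-weakenᵗ (λ arc v-window → Arc-unwrapped 3<M arc (inj₂ (≤-trans 3≤p (proj₁ v-window))))
      (head P) (internal P) (Linked-++⁻ˡ (toList Q) Q∷P-linked) (All.tail Q-window)

    δ : ℕ
    δ = arcDiff (last Q) (last P)

  arcSum-window : ∀ {p c} (P : Walk M) → 3 ≤ p → c < M → Linked Arc (toList P) → 1 ≤ len P →
    All (InWindow p c) (srcInt P) → last P ≡ ρ^ c (head P) → arcSum P ≡ c
  arcSum-window {p} {c} P 3≤p c<M linked 1≤len window period =
    +-cancelˡ-≡ (sub (head P)) (arcSum P) c (%-injective-window′ x<y+M y<x+M x≡y-mod)
    where
    p≤head : p ≤ sub (head P)
    p≤head = proj₁ (All.head (subst (All (InWindow p c)) (srcInt-∷ P 1≤len) window))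

    x≡y-mod : (sub (head P) + arcSum P) % M ≡ (sub (head P) + c) % M
    x≡y-mod = trans (telescope-mod P) (trans (cong sub period) (toℕ-+ᶠ (proj₁ (head P)) c))

    x<y+M : sub (head P) + arcSum P < sub (head P) + c + M
    x<y+M = begin-strict
      sub (head P) + arcSum P   <⟨ arcSum-window-bound P 3≤p linked 1≤len window ⟩
      p + c + 3                 ≤⟨ +-mono-≤ (+-monoˡ-≤ c p≤head) (≤-trans 3≤p (<⇒≤ (≤-<-trans p≤head (toℕ<n (proj₁ (head P)))))) ⟩
      sub (head P) + c + M      ∎
      where open ≤-Reasoning

    y<x+M : sub (head P) + c < sub (head P) + arcSum P + M
    y<x+M = begin-strict
      sub (head P) + c            <⟨ +-monoʳ-< (sub (head P)) c<M ⟩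
      sub (head P) + M            ≤⟨ +-monoˡ-≤ M (m≤m+n (sub (head P)) (arcSum P)) ⟩
      sub (head P) + arcSum P + M ∎
      where open ≤-Reasoning

-- A walk followed by the translates of a periodic dipath

translates : ∀ {m} → ℕ → Walk m → Walk m → ℕ → Walk m
translates c X P zero    = X
translates c X P (suc i) = translates c X P i ⋯ ρ^W (c * i) P

blocks : ∀ {m} → ℕ → Walk m → ℕ → List (Vertex m)
blocks c P zero    = []
blocks c P (suc i) = blocks c P i ++ List.map (ρ^ (c * i)) (srcInt P)

foldl-⋯≡translates : ∀ {m} (c : ℕ) (X P : Walk m) (i : ℕ) →
  List.foldl _⋯_ X (List.map (λ j → ρ^W (c * j) P) (List.upTo i)) ≡ translates c X P i
foldl-⋯≡translates c X P zero    = refl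
foldl-⋯≡translates c X P (suc i) = begin
  List.foldl _⋯_ X (List.map F (List.upTo (suc i)))
    ≡⟨ cong (λ js → List.foldl _⋯_ X (List.map F js)) (applyUpTo-∷ʳ (λ j → j) i) ⟨
  List.foldl _⋯_ X (List.map F (List.upTo i ∷ʳ i))
    ≡⟨ cong (List.foldl _⋯_ X) (map-++ F (List.upTo i) [ i ]) ⟩
  List.foldl _⋯_ X (List.map F (List.upTo i) ∷ʳ F i)
    ≡⟨ foldl-∷ʳ _⋯_ X (F i) (List.map F (List.upTo i)) ⟩
  List.foldl _⋯_ X (List.map F (List.upTo i)) ⋯ F i
    ≡⟨ cong (_⋯ F i) (foldl-⋯≡translates c X P i) ⟩
  translates c X P i ⋯ F i
    ∎
  where
  open ≡-Reasoning
  F = λ j → ρ^W (c * j) P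

module Translates {n : ℕ} (c : ℕ) {X P : Walk (suc n)}
  (X↝P : last X ≡ head P) (P↝ρP : last P ≡ ρ^ c (head P)) where

  private
    T : ℕ → Walk (suc n)
    T = translates c X P

    Pᵢ : ℕ → Walk (suc n)
    Pᵢ i = ρ^W (c * i) P

  last-translates : ∀ i → last (T i) ≡ ρ^ (c * i) (last X)
  joined : ∀ i → last (T i) ≡ head (Pᵢ i)
  joined i = trans (last-translates i) (cong (ρ^ (c * i)) X↝P)

  last-translates zero    = sym (trans (cong (λ j → ρ^ j (last X)) (*-zeroʳ c)) (ρ^-zero (last X)))
  last-translates (suc i) = begin
    last (T i ⋯ Pᵢ i)             ≡⟨ last-⋯ (T i) (Pᵢ i) (joined i) ⟩
    last (Pᵢ i)                   ≡⟨ last-ρ^W (c * i) P ⟩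
    ρ^ (c * i) (last P)           ≡⟨ cong (ρ^ (c * i)) P↝ρP ⟩
    ρ^ (c * i) (ρ^ c (head P))    ≡⟨ ρ^-∘ c (c * i) (head P) ⟩
    ρ^ (c + c * i) (head P)       ≡⟨ cong₂ ρ^ (*-suc c i) X↝P ⟨
    ρ^ (c * suc i) (last X)       ∎
    where open ≡-Reasoning

  head-translates : ∀ i → head (T i) ≡ head X
  head-translates zero    = refl
  head-translates (suc i) = head-translates i

  Linked-translates : Linked Arc (toList X) → Linked Arc (toList P) → ∀ i → Linked Arc (toList (T i))
  Linked-translates lX lP zero    = lX
  Linked-translates lX lP (suc i) =
    Linked-⋯ (T i) (Pᵢ i) (joined i) (Linked-translates lX lP i) (Linked-ρ^W (c * i) P lP)

  len-translates : ∀ i → len (T i) ≡ len X + i * len P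
  len-translates zero    = sym (+-identityʳ (len X))
  len-translates (suc i) = begin
    len (T i ⋯ Pᵢ i)              ≡⟨ len-⋯ (T i) (Pᵢ i) ⟩
    len (T i) + len (Pᵢ i)        ≡⟨ cong₂ _+_ (len-translates i) (len-ρ^W (c * i) P) ⟩
    len X + i * len P + len P     ≡⟨ +-assoc (len X) (i * len P) (len P) ⟩
    len X + (i * len P + len P)   ≡⟨ cong (len X +_) (+-comm (i * len P) (len P)) ⟩
    len X + suc i * len P         ∎
    where open ≡-Reasoning

  arcSum-translates : ∀ i → arcSum (T i) ≡ arcSum X + i * arcSum P
  arcSum-translates zero    = sym (+-identityʳ (arcSum X))
  arcSum-translates (suc i) = begin
    arcSum (T i ⋯ Pᵢ i)                    ≡⟨ arcSum-⋯ (T i) (Pᵢ i) (joined i) ⟩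
    arcSum (T i) + arcSum (Pᵢ i)           ≡⟨ cong₂ _+_ (arcSum-translates i) (arcSum-ρ^W (c * i) P) ⟩
    arcSum X + i * arcSum P + arcSum P     ≡⟨ +-assoc (arcSum X) (i * arcSum P) (arcSum P) ⟩
    arcSum X + (i * arcSum P + arcSum P)   ≡⟨ cong (arcSum X +_) (+-comm (i * arcSum P) (arcSum P)) ⟩
    arcSum X + suc i * arcSum P            ∎
    where open ≡-Reasoning

  srcInt-translates : ∀ i → srcInt (T i) ≡ srcInt X ++ blocks c P i
  srcInt-translates zero    = sym (++-identityʳ (srcInt X))
  srcInt-translates (suc i) = begin
    srcInt (T i ⋯ Pᵢ i)                                             ≡⟨ srcInt-⋯ (T i) (Pᵢ i) (joined i) ⟩
    srcInt (T i) ++ srcInt (Pᵢ i)                                   ≡⟨ cong₂ _++_ (srcInt-translates i) (srcInt-ρ^W (c * i) P) ⟩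
    (srcInt X ++ blocks c P i) ++ List.map (ρ^ (c * i)) (srcInt P)  ≡⟨ ++-assoc (srcInt X) (blocks c P i) _ ⟩
    srcInt X ++ blocks c P (suc i)                                  ∎
    where open ≡-Reasoning

∈-blocks⁻ : ∀ {m} (c : ℕ) (P : Walk m) (i : ℕ) {v : Vertex m} → v ∈ blocks c P i →
  ∃[ j ] j < i × ∃[ u ] u ∈ srcInt P × v ≡ ρ^ (c * j) u
∈-blocks⁻ c P (suc i) v∈ with ∈-++⁻ (blocks c P i) v∈
... | inj₁ v∈ᵢ with ∈-blocks⁻ c P i v∈ᵢ
...   | j , j<i , rest = j , m<n⇒m<1+n j<i , rest
∈-blocks⁻ c P (suc i) v∈ | inj₂ v∈ρ with ∈-map⁻ (ρ^ (c * i)) v∈ρ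
...   | u , u∈ , v≡ = i , ≤-refl , u , u∈ , v≡

module Blocks {n : ℕ} (p c k : ℕ) (fits : p + c * k ≤ suc n) where
  private
    M = suc n

  below-next-window : ∀ {a i j} → a < p + c → j < i → a + c * j < p + c * i
  below-next-window {a} {i} {j} a<p+c j<i = begin-strict
    a + c * j          <⟨ +-monoˡ-< (c * j) a<p+c ⟩
    p + c + c * j      ≡⟨ +-assoc p c (c * j) ⟩
    p + (c + c * j)    ≡⟨ cong (p +_) (*-suc c j) ⟨
    p + c * suc j      ≤⟨ +-monoʳ-≤ p (*-monoʳ-≤ c j<i) ⟩
    p + c * i          ∎
    where open ≤-Reasoning

  sub-translate : ∀ {u} j → InWindow p c u → j < k → sub (ρ^ (c * j) u) ≡ sub u + c * j
  sub-translate {u} j (_ , u<p+c) j<k =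
    sub-ρ^ (c * j) u (<-≤-trans (below-next-window u<p+c j<k) fits)

  window-index-unique : ∀ {a b i j} → p ≤ a → a < p + c → p ≤ b → b < p + c →
    a + c * j ≡ b + c * i → j ≡ i
  window-index-unique {a} {b} {i} {j} p≤a a<p+c p≤b b<p+c eq with <-cmp j i
  ... | tri< j<i _ _ = contradiction eq
          (<⇒≢ (<-≤-trans (below-next-window {a} {i} {j} a<p+c j<i) (+-monoˡ-≤ (c * i) p≤b)))
  ... | tri> _ _ i<j = contradiction (sym eq)
          (<⇒≢ (<-≤-trans (below-next-window {b} {j} {i} b<p+c i<j) (+-monoˡ-≤ (c * j) p≤a)))
  ... | tri≈ _ j≡i _ = j≡i

  translate-injective : ∀ {u w i j} → InWindow p c u → InWindow p c w → j < k → i < k →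
    ρ^ (c * j) u ≡ ρ^ (c * i) w → j ≡ i × u ≡ w
  translate-injective {u} {w} {i} {j} (p≤u , u<p+c) (p≤w , w<p+c) j<k i<k eq
    = j≡i , ρ^-injective (c * j) (trans eq (cong (λ l → ρ^ (c * l) w) (sym j≡i)))
    where
    sub-eq : sub u + c * j ≡ sub w + c * i
    sub-eq = begin
      sub u + c * j          ≡⟨ sub-translate {u} j (p≤u , u<p+c) j<k ⟨
      sub (ρ^ (c * j) u)     ≡⟨ cong sub eq ⟩
      sub (ρ^ (c * i) w)     ≡⟨ sub-translate {w} i (p≤w , w<p+c) i<k ⟩
      sub w + c * i          ∎
      where open ≡-Reasoning

    j≡i : j ≡ i
    j≡i = window-index-unique p≤u u<p+c p≤w w<p+c sub-eq

  module _ {P : Walk M} (P-window : All (InWindow p c) (srcInt P)) where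

    blocks-above : ∀ {v} → v ∈ blocks c P k → p ≤ sub v
    blocks-above v∈ with ∈-blocks⁻ c P k v∈
    ... | j , j<k , u , u∈ , refl = begin
      p                    ≤⟨ proj₁ (All.lookup P-window u∈) ⟩
      sub u                ≤⟨ m≤m+n (sub u) (c * j) ⟩
      sub u + c * j        ≡⟨ sub-translate {u} j (All.lookup P-window u∈) j<k ⟨
      sub (ρ^ (c * j) u)   ∎
      where open ≤-Reasoning

    Unique-blocks : Unique (srcInt P) → ∀ i → i ≤ k → Unique (blocks c P i)
    Unique-blocks uP zero    _   = []ᴾ
    Unique-blocks uP (suc i) i<k =
      Unique.++⁺ (Unique-blocks uP i (<⇒≤ i<k)) (Unique.map⁺ (ρ^-injective (c * i)) uP) new-block
      where
      new-block : Disjointᴸ (blocks c P i) (List.map (ρ^ (c * i)) (srcInt P))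
      new-block (v∈old , v∈new) with ∈-blocks⁻ c P i v∈old | ∈-map⁻ (ρ^ (c * i)) v∈new
      ... | j , j<i , u , u∈ , refl | w , w∈ , eq = <-irrefl j≡i j<i
        where
        j≡i = proj₁ (translate-injective (All.lookup P-window u∈) (All.lookup P-window w∈) (<-trans j<i i<k) i<k eq)

  blocks-disjoint : ∀ {P Q : Walk M} → All (InWindow p c) (srcInt P) → All (InWindow p c) (srcInt Q) →
    Disjointᴸ (srcInt P) (srcInt Q) → Disjointᴸ (blocks c P k) (blocks c Q k)
  blocks-disjoint {P} {Q} P-window Q-window disjoint (v∈P , v∈Q) with ∈-blocks⁻ c P k v∈P | ∈-blocks⁻ c Q k v∈Q
  ... | j , j<k , u , u∈ , refl | i , i<k , w , w∈ , eq = disjoint (u∈ , subst (_∈ srcInt Q) (sym u≡w) w∈)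
    where
    u≡w = proj₂ (translate-injective (All.lookup P-window u∈) (All.lookup Q-window w∈) j<k i<k eq)

-- Type-1 basic sets

module TypeOneCycle {p′ k : ℕ} (3≤p : 3 ≤ suc p′) (1≤k : 1 ≤ k) {X P : Walk (suc p′ + 12 * k)}
  (X-dipath : IsDipath X) (P-dipath : IsDipath P)
  (X-period : head X ≡ ρ^- (suc p′) (last X)) (len-X : len X ≡ suc p′) (len-P : len P ≡ 12)
  (X-low : All (InV0 (suc p′) k) (srcInt X)) (X-end : TerminusOK (suc p′) k (last X))
  (X↝P : last X ≡ head P) (P-C6 : C6 (suc p′) k P) where

  private
    p = suc p′
    M = p + 12 * k

  p+12≤M : p + 12 ≤ M
  p+12≤M = +-monoʳ-≤ p (*-monoʳ-≤ 12 1≤k)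

  terminus-offset : ∃[ e ] e ≤ 2 × sub (last X) ≡ p + e
  terminus-offset = from-terminus X-end
    where
    offset : ∀ {t} → (t ≡ p ⊎ t ≡ p + 1 ⊎ t ≡ p + 2) → ∃[ e ] e ≤ 2 × t ≡ p + e
    offset (inj₁ t≡p)          = 0 , z≤n , trans t≡p (sym (+-identityʳ p))
    offset (inj₂ (inj₁ t≡p+1)) = 1 , s≤s z≤n , t≡p+1
    offset (inj₂ (inj₂ t≡p+2)) = 2 , s≤s (s≤s z≤n) , t≡p+2

    -- TerminusOK fixes t only modulo M, and t < M forces the quotient q to vanish.
    from-terminus : TerminusOK p k (last X) → ∃[ e ] e ≤ 2 × sub (last X) ≡ p + e
    from-terminus (t , t-choice , q , t≡) with offset t-choice
    ... | e , e≤2 , t≡p+e = e , e≤2 , trans (sym (t≡sub q t≡)) t≡p+e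
      where
      t<M : t < M
      t<M = begin-strict
        t        ≡⟨ t≡p+e ⟩
        p + e    <⟨ +-monoʳ-< p (s≤s (≤-trans e≤2 (s≤s (s≤s z≤n)))) ⟩
        p + 12   ≤⟨ p+12≤M ⟩
        M        ∎
        where open ≤-Reasoning

      t≡sub : ∀ q → t ≡ sub (last X) + q * M → t ≡ sub (last X)
      t≡sub zero    t≡ = trans t≡ (+-identityʳ _)
      t≡sub (suc q) t≡ = contradiction
        (subst (M ≤_) (sym t≡) (≤-trans (m≤m+n M (q * M)) (m≤n+m _ (sub (last X))))) (<⇒≱ t<M)

  private
    e = proj₁ terminus-offset
    e≤2 = proj₁ (proj₂ terminus-offset)
    sub-last-X = proj₂ (proj₂ terminus-offset)

    3<M : 3 < M
    3<M = <-≤-trans (≤-<-trans 3≤p (m<m+n p (s≤s z≤n))) p+12≤M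

  sub-head-X : sub (head X) ≡ e
  sub-head-X = begin
    sub (head X)                  ≡⟨ cong sub X-period ⟩
    sub (ρ^- p (last X))          ≡⟨ sub-ρ^- p (last X) (subst (p ≤_) (sym sub-last-X) (m≤m+n p e)) ⟩
    sub (last X) ∸ p              ≡⟨ cong (_∸ p) sub-last-X ⟩
    p + e ∸ p                     ≡⟨ m+n∸m≡n p e ⟩
    e                             ∎
    where open ≡-Reasoning

  arcSum-X : arcSum X ≡ p
  arcSum-X = +-cancelˡ-≡ e (arcSum X) p (begin
    e + arcSum X                  ≡⟨ cong (_+ arcSum X) sub-head-X ⟨
    sub (head X) + arcSum X       ≡⟨ telescope-below X 3<M (proj₁ X-dipath) (All.map (λ {v} → below {v}) X-low) ⟨
    sub (last X)                  ≡⟨ sub-last-X ⟩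
    p + e                         ≡⟨ +-comm p e ⟩
    e + p                         ∎)
    where
    open ≡-Reasoning
    below : ∀ {v} → sub v < p → sub v + 3 < M
    below v<p = <-≤-trans (+-monoˡ-< 3 v<p) (≤-trans (+-monoʳ-≤ p (s≤s (s≤s (s≤s z≤n)))) p+12≤M)

  P-window : All (InWindow p 12) (srcInt P)
  P-window = subst (All (InWindow p 12)) (sym (srcInt-∷ P (subst (1 ≤_) (sym len-P) (s≤s z≤n))))
    (head-window ∷ᴬ proj₂ P-C6)
    where
    sub-head-P : sub (head P) ≡ p + e
    sub-head-P = trans (cong sub (sym X↝P)) sub-last-X
    head-window : InWindow p 12 (head P)
    head-window = subst (p ≤_) (sym sub-head-P) (m≤m+n p e) ,
                  subst (_< p + 12) (sym sub-head-P) (+-monoʳ-< p (s≤s (≤-trans e≤2 (s≤s (s≤s z≤n)))))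

  arcSum-P : arcSum P ≡ 12
  arcSum-P = arcSum-window P 3≤p (<-≤-trans (m<n+m 12 (s≤s z≤n)) p+12≤M) (proj₁ P-dipath)
    (subst (1 ≤_) (sym len-P) (s≤s z≤n)) P-window (proj₁ P-C6)

  open Translates 12 {X} {P} X↝P (proj₁ P-C6)
  open Blocks p 12 k ≤-refl

  C : Walk M
  C = translates 12 X P k

  C-closed : head C ≡ last C
  C-closed = begin
    head C                        ≡⟨ head-translates k ⟩
    head X                        ≡⟨ ρ^-multiple 1 (head X) ⟨
    ρ^ (1 * M) (head X)           ≡⟨ cong (λ j → ρ^ j (head X)) (*-identityˡ M) ⟩
    ρ^ (p + 12 * k) (head X)      ≡⟨ ρ^-∘ p (12 * k) (head X) ⟨
    ρ^ (12 * k) (ρ^ p (head X))   ≡⟨ cong (ρ^ (12 * k)) (trans (cong (ρ^ p) X-period) (ρ^-ρ^- p (last X))) ⟩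
    ρ^ (12 * k) (last X)          ≡⟨ last-translates k ⟨
    last C                        ∎
    where open ≡-Reasoning

  len-C : len C ≡ M
  len-C = begin
    len C                         ≡⟨ len-translates k ⟩
    len X + k * len P             ≡⟨ cong₂ (λ a b → a + k * b) len-X len-P ⟩
    p + k * 12                    ≡⟨ cong (p +_) (*-comm k 12) ⟩
    M                             ∎
    where open ≡-Reasoning

  arcSum-C : arcSum C ≡ 1 * M
  arcSum-C = begin
    arcSum C                      ≡⟨ arcSum-translates k ⟩
    arcSum X + k * arcSum P       ≡⟨ cong₂ (λ a b → a + k * b) arcSum-X arcSum-P ⟩
    p + k * 12                    ≡⟨ cong (p +_) (*-comm k 12) ⟩
    M                             ≡⟨ *-identityˡ M ⟨
    1 * M                         ∎
    where open ≡-Reasoning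

  srcInt-C : srcInt C ≡ srcInt X ++ blocks 12 P k
  srcInt-C = srcInt-translates k

  Unique-srcInt-C : Unique (srcInt C)
  Unique-srcInt-C = subst Unique (sym srcInt-C)
    (Unique.++⁺ (Unique-srcInt X (proj₂ X-dipath))
                (Unique-blocks P-window (Unique-srcInt P (proj₂ P-dipath)) k ≤-refl)
                (low-high-disjoint X-low (blocks-above P-window)))

  C-type-one : IsTypeCycle M 1 C
  C-type-one =
    closed-IsDirCycle C (Linked-translates (proj₁ X-dipath) (proj₁ P-dipath) k) C-closed Unique-srcInt-C
      (subst (1 ≤_) (sym len-C) (s≤s z≤n)) ,
    len-C , arcSum-C

TwoCycleFactor : (m j : ℕ) → Walk m → Walk m → Set
TwoCycleFactor m j C₀ C₁ = IsTypeCycle m j C₀ × IsTypeCycle m j C₁ × IsCmFactor m (C₀ ∷ C₁ ∷ [])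

disjoint-cycles-factor : (m j : ℕ) (C₀ C₁ : Walk m) → IsTypeCycle m j C₀ → IsTypeCycle m j C₁ →
  Disjoint C₀ C₁ → TwoCycleFactor m j C₀ C₁
disjoint-cycles-factor m j C₀ C₁ cycle₀ cycle₁ disjoint = cycle₀ , cycle₁ ,
  IsCmFactor-pair C₀ C₁ (proj₁ cycle₀) (proj₁ cycle₁) (proj₁ (proj₂ cycle₀)) (proj₁ (proj₂ cycle₁))
    (Unique.++⁺ (unique-tail cycle₀) (unique-tail cycle₁) (λ (v∈₀ , v∈₁) → disjoint _ (there v∈₀) (there v∈₁)))
  where
  unique-tail : ∀ {C} → IsTypeCycle m j C → Unique (tail C)
  unique-tail ((_ , _ , unique , _) , _) = unique

type-one-factor : ∀ p′ k → 3 ≤ suc p′ → (X Y P Q : Walk (suc p′ + 12 * k)) →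
  Type1Basic (suc p′) k X Y P Q →
  TwoCycleFactor (suc p′ + 12 * k) 1 (chain (suc p′) k X P) (chain (suc p′) k Y Q)
type-one-factor p′ zero 3≤p X Y P Q (_ , _ , cycles , _) with cycles refl
... | X-cycle , Y-cycle , disjoint = disjoint-cycles-factor _ 1 X Y X-cycle Y-cycle disjoint
type-one-factor p′ k@(suc _) 3≤p X Y P Q
  ((P-dipath , Q-dipath , P∩Q) , dipaths , _ , X-period , Y-period , len-X , len-Y , lens , _ ,
   X-low , X-end , Y-low , Y-end , X↝P , Y↝Q , c6)
  with dipaths (s≤s z≤n) | lens (s≤s z≤n) | c6 (s≤s z≤n)
... | X-dipath , Y-dipath , X∩Y | len-P , len-Q | P-C6 , Q-C6 =
  subst₂ (TwoCycleFactor M 1) (sym (foldl-⋯≡translates 12 X P k)) (sym (foldl-⋯≡translates 12 Y Q k))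
    (Cycle₀.C-type-one , Cycle₁.C-type-one ,
     IsCmFactor-pair Cycle₀.C Cycle₁.C (proj₁ Cycle₀.C-type-one) (proj₁ Cycle₁.C-type-one)
       Cycle₀.len-C Cycle₁.len-C unique-tails)
  where
  M = suc p′ + 12 * k
  module Cycle₀ = TypeOneCycle 3≤p (s≤s z≤n) X-dipath P-dipath X-period len-X len-P X-low X-end X↝P P-C6
  module Cycle₁ = TypeOneCycle 3≤p (s≤s z≤n) Y-dipath Q-dipath Y-period len-Y len-Q Y-low Y-end Y↝Q Q-C6
  open Blocks (suc p′) 12 k ≤-refl

  srcInt-disjoint : Disjointᴸ (srcInt Cycle₀.C) (srcInt Cycle₁.C)
  srcInt-disjoint = subst₂ Disjointᴸ (sym Cycle₀.srcInt-C) (sym Cycle₁.srcInt-C)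
    (Disjoint-++ (Disjoint-srcInt X∩Y)
                 (low-high-disjoint X-low (blocks-above Cycle₁.P-window))
                 (Disjointᴸ-sym (low-high-disjoint Y-low (blocks-above Cycle₀.P-window)))
                 (blocks-disjoint Cycle₀.P-window Cycle₁.P-window (Disjoint-srcInt P∩Q)))

  unique-tails : Unique (tail Cycle₀.C ++ tail Cycle₁.C)
  unique-tails = Unique-resp-↭
    (↭-sym (Perm.++⁺ (tail↭srcInt Cycle₀.C Cycle₀.C-closed) (tail↭srcInt Cycle₁.C Cycle₁.C-closed)))
    (Unique.++⁺ Cycle₀.Unique-srcInt-C Cycle₁.Unique-srcInt-C srcInt-disjoint)

lemma17 : (p k : ℕ) → p ∈ (11 ∷ 13 ∷ 17 ∷ 19 ∷ []) →
    (X Y P₀ Q₀ : Walk (p + 12 * k)) →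
    Type1Basic p k X Y P₀ Q₀ →
    IsTypeCycle (p + 12 * k) 1 (chain p k X P₀)
    × IsTypeCycle (p + 12 * k) 1 (chain p k Y Q₀)
    × IsCmFactor (p + 12 * k) (chain p k X P₀ ∷ chain p k Y Q₀ ∷ [])
lemma17 .11 k (here refl)                         = type-one-factor 10 k (m≤m+n 3 8)
lemma17 .13 k (there (here refl))                 = type-one-factor 12 k (m≤m+n 3 10)
lemma17 .17 k (there (there (here refl)))         = type-one-factor 16 k (m≤m+n 3 14)
lemma17 .19 k (there (there (there (here refl)))) = type-one-factor 18 k (m≤m+n 3 16)
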